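{- Let $t$ be an integer of the form $t=3x^2-y^2$ with $x,y\in\mathbb{Z}$. Then $t$ is a sum of two squares of integers if and only if $t=2(m^2-mn+n^2)$ for some integers $m,n$. -}

module Defs where

-- Write x = g₁ x₀, y = g₁ y₀, and likewise the second representation of t,
-- with coprime primitive parts. Cancelling gcd (g₁, g₂)² shows that both
-- primitive values are square multiples h² M, g² M of one cofactor M, and
-- t = s² M. Coprimality makes 3 a square modulo 3x₀² - y₀², -1 a square
-- modulo a₀² + b₀² and -3 a square modulo m₀² - m₀ n₀ + n₀², hence modulo M.
-- A square root of -D modulo M yields a form of determinant D with leading
-- coefficient M, and Lagrange-Gauss reduction shows that M is represented by
-- x² + y² if D = 1 and by x² + 3y² or 2(x² - xy + y²) if D = 3.
-- If t = a² + b², then -3 = -1 · 3 is a square modulo M, and x² + 3y² is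
-- excluded modulo 4. If t = 2(m² - mn + n²), then M = 2M′ with M′ odd, the
-- cofactors of 3 in both forms show 3 ∤ M′, so -1 = (-3) · 3 / 3² is a square
-- modulo M′, M′ = p² + q² and t = s² ((p + q)² + (p - q)²).

module Submission where

open import Defs
open import Data.Empty using (⊥; ⊥-elim)
open import Data.Integer as ℤ using (ℤ; +_; -[1+_]; 0ℤ; 1ℤ; -1ℤ; _+_; _-_; _*_; -_; ∣_∣; _%ℕ_; _/ℕ_)
open import Data.Integer.DivMod using (a≡a%ℕn+[a/ℕn]*n; n%ℕd<d)
import Data.Integer.Properties as ℤₚ
open import Data.Integer.Tactic.RingSolver using (solve-∀)
open import Data.Nat as ℕ using (ℕ; zero; suc; z≤n; s≤s; NonZero; _<_; _%_)
open import Data.Nat.Divisibility using (divides; 0∣⇒≡0)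
open import Data.Nat.DivMod using ([m+kn]%n≡m%n; m<n⇒m%n≡m)
open import Data.Nat.GCD using (module GCD; module Bézout)
open import Data.Nat.Induction using (<-wellFounded)
import Data.Nat.Properties as ℕₚ
open import Data.Nat.Properties using (allUpTo?; _≟_)
open import Data.Nat.Tactic.RingSolver using () renaming (solve-∀ to ℕ-solve-∀)
open import Data.Product using (∃; ∃₂; _×_; _,_; proj₁; proj₂)
open import Data.Sum using (_⊎_; inj₁; inj₂; [_,_]′)
open import Induction.WellFounded using (Acc; acc)
open import Relation.Binary.PropositionalEquality
open import Relation.Nullary using (Dec; yes; no)
open import Relation.Nullary.Decidable using (from-yes; _→-dec_; _⊎-dec_; ¬?)
open import Relation.Unary using (_⊆_; _∪_)

-- Congruences and residue computations

module Residues (n : ℕ) .{{_ : NonZero n}} where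

  infix 4 _≈_
  infixl 6 _⊕_
  infixl 7 _⊗_

  -- Pushing an integer identity through ⊕ and ⊗ turns it into an identity
  -- between residues below n, which the lemmas below decide by enumeration.
  _≈_ : ℤ → ℕ → Set
  a ≈ r = ∃ λ k → a ≡ + r + k * + n

  ⌊_⌋ : ∀ a → a ≈ a %ℕ n
  ⌊ a ⌋ = a /ℕ n , a≡a%ℕn+[a/ℕn]*n a n

  ‵_ : ∀ r → + r ≈ r
  ‵ r = 0ℤ , sym (ℤₚ.+-identityʳ (+ r))

  _⊕_ : ∀ {a b r s} → a ≈ r → b ≈ s → a + b ≈ r ℕ.+ s
  _⊕_ {a} {b} {r} {s} (k , a≡) (l , b≡) = k + l , (begin
    a + b                             ≡⟨ cong₂ _+_ a≡ b≡ ⟩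
    + r + k * + n + (+ s + l * + n)   ≡⟨ regroup (+ r) (+ s) k l (+ n) ⟩
    + r + + s + (k + l) * + n         ≡⟨ cong (_+ (k + l) * + n) (ℤₚ.pos-+ r s) ⟨
    + (r ℕ.+ s) + (k + l) * + n       ∎)
    where
    open ≡-Reasoning
    regroup : ∀ r s k l n → r + k * n + (s + l * n) ≡ r + s + (k + l) * n
    regroup = solve-∀

  _⊗_ : ∀ {a b r s} → a ≈ r → b ≈ s → a * b ≈ r ℕ.* s
  _⊗_ {a} {b} {r} {s} (k , a≡) (l , b≡) = m , (begin
    a * b                             ≡⟨ cong₂ _*_ a≡ b≡ ⟩
    (+ r + k * + n) * (+ s + l * + n) ≡⟨ expand (+ r) (+ s) k l (+ n) ⟩
    + r * + s + m * + n               ≡⟨ cong (_+ m * + n) (ℤₚ.pos-* r s) ⟨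
    + (r ℕ.* s) + m * + n             ∎)
    where
    open ≡-Reasoning
    m = + r * l + k * + s + k * l * + n
    expand : ∀ r s k l n → (r + k * n) * (s + l * n) ≡ r * s + (r * l + k * s + k * l * n) * n
    expand = solve-∀

  private
    %-of-multiple : ∀ r s k → + r ≡ + s + + k * + n → r % n ≡ s % n
    %-of-multiple r s k eq = begin
      r % n                  ≡⟨ cong (ℕ._% n) (ℤₚ.+-injective (trans eq as-ℕ)) ⟩
      (s ℕ.+ k ℕ.* n) % n    ≡⟨ [m+kn]%n≡m%n s k n ⟩
      s % n                  ∎
      where
      open ≡-Reasoning
      as-ℕ : + s + + k * + n ≡ + (s ℕ.+ k ℕ.* n)
      as-ℕ = trans (cong (_+_ (+ s)) (sym (ℤₚ.pos-* k n))) (sym (ℤₚ.pos-+ s (k ℕ.* n)))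

    %-cong : ∀ r s k → + r ≡ + s + k * + n → r % n ≡ s % n
    %-cong r s (+ k) eq = %-of-multiple r s k eq
    %-cong r s -[1+ k ] eq = sym (%-of-multiple s r (suc k) (begin
      + s                                       ≡⟨ cancel (+ s) -[1+ k ] (+ n) ⟨
      + s + -[1+ k ] * + n + + suc k * + n      ≡⟨ cong (_+ + suc k * + n) eq ⟨
      + r + + suc k * + n                       ∎))
      where
      open ≡-Reasoning
      cancel : ∀ s k n → s + k * n + (- k) * n ≡ s
      cancel = solve-∀

  ≈-unique : ∀ {a r s} → a ≈ r → a ≈ s → r % n ≡ s % n
  ≈-unique {a} {r} {s} (k , a≡r) (l , a≡s) = %-cong r s (l - k) (begin
    + r                          ≡⟨ shift (+ r) (k * + n) ⟨
    + r + k * + n - k * + n      ≡⟨ cong (_- k * + n) (trans (sym a≡r) a≡s) ⟩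
    + s + l * + n - k * + n      ≡⟨ collect (+ s) l k (+ n) ⟩
    + s + (l - k) * + n          ∎)
    where
    open ≡-Reasoning
    shift : ∀ x y → x + y - y ≡ x
    shift = solve-∀
    collect : ∀ s l k n → s + l * n - k * n ≡ s + (l - k) * n
    collect = solve-∀

  residue : ∀ {a r} → a ≈ r → a %ℕ n ≡ r % n
  residue {a} a≈r = trans (sym (m<n⇒m%n≡m (n%ℕd<d a n))) (≈-unique ⌊ a ⌋ a≈r)

  ≈-≡ : ∀ {a b r s} → a ≡ b → a ≈ r → b ≈ s → r % n ≡ s % n
  ≈-≡ refl = ≈-unique

  divMod : ∀ a {r} → a %ℕ n ≡ r → a ≡ + r + (a /ℕ n) * + n
  divMod a refl = a≡a%ℕn+[a/ℕn]*n a n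

3x²-y² x²+y² x²-xy+y² x²+3y² 2[x²-xy+y²] : ℤ → ℤ → ℤ
3x²-y² x y = + 3 * (x * x) - y * y
x²+y² x y = x * x + y * y
x²-xy+y² x y = x * x - x * y + y * y
x²+3y² x y = x * x + + 3 * (y * y)
2[x²-xy+y²] x y = + 2 * x²-xy+y² x y

Represented : (ℤ → ℤ → ℤ) → ℤ → Set
Represented Q t = ∃₂ λ x y → t ≡ Q x y

record Coprime (x y : ℤ) : Set where
  constructor bézout
  field
    u v : ℤ
    identity : u * x + v * y ≡ 1ℤ

module Mod4 = Residues 4
module Mod3 = Residues 3

3x²-y²-mod-4 : ∀ {x y} → Coprime x y → 3x²-y² x y %ℕ 4 ≡ 2 ⊎ 3x²-y² x y %ℕ 4 ≡ 3
3x²-y²-mod-4 {x} {y} (bézout u v identity) =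
  check (n%ℕd<d u 4) (n%ℕd<d v 4) (n%ℕd<d x 4) (n%ℕd<d y 4) (n%ℕd<d t 4)
    (≈-≡ identity (⌊ u ⌋ ⊗ ⌊ x ⌋ ⊕ ⌊ v ⌋ ⊗ ⌊ y ⌋) (‵ 1))
    (≈-≡ (add-y² x y) (⌊ t ⌋ ⊕ ⌊ y ⌋ ⊗ ⌊ y ⌋) (‵ 3 ⊗ (⌊ x ⌋ ⊗ ⌊ x ⌋)))
  where
  open Mod4
  t = 3x²-y² x y
  add-y² : ∀ x y → + 3 * (x * x) - y * y + y * y ≡ + 3 * (x * x)
  add-y² = solve-∀
  check : ∀ {u} → u < 4 → ∀ {v} → v < 4 → ∀ {x} → x < 4 → ∀ {y} → y < 4 → ∀ {t} → t < 4 →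
    (u ℕ.* x ℕ.+ v ℕ.* y) % 4 ≡ 1 → (t ℕ.+ y ℕ.* y) % 4 ≡ (3 ℕ.* (x ℕ.* x)) % 4 → t ≡ 2 ⊎ t ≡ 3
  check = from-yes (allUpTo? (λ u → allUpTo? (λ v → allUpTo? (λ x → allUpTo? (λ y → allUpTo? (λ t →
    (u ℕ.* x ℕ.+ v ℕ.* y) % 4 ≟ 1 →-dec (t ℕ.+ y ℕ.* y) % 4 ≟ (3 ℕ.* (x ℕ.* x)) % 4 →-dec
    (t ≟ 2 ⊎-dec t ≟ 3))
    4) 4) 4) 4) 4)

x²+y²∩x²+3y²-mod-4 : ∀ {m} → Represented x²+y² m → Represented x²+3y² m → m %ℕ 4 ≡ 0 ⊎ m %ℕ 4 ≡ 1
x²+y²∩x²+3y²-mod-4 {m} (p , q , m≡p²+q²) (s , w , m≡s²+3w²) =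
  check (n%ℕd<d m 4) (n%ℕd<d p 4) (n%ℕd<d q 4) (n%ℕd<d s 4) (n%ℕd<d w 4)
    (≈-≡ m≡p²+q² ⌊ m ⌋ (⌊ p ⌋ ⊗ ⌊ p ⌋ ⊕ ⌊ q ⌋ ⊗ ⌊ q ⌋))
    (≈-≡ m≡s²+3w² ⌊ m ⌋ (⌊ s ⌋ ⊗ ⌊ s ⌋ ⊕ ‵ 3 ⊗ (⌊ w ⌋ ⊗ ⌊ w ⌋)))
  where
  open Mod4
  check : ∀ {m} → m < 4 → ∀ {p} → p < 4 → ∀ {q} → q < 4 → ∀ {s} → s < 4 → ∀ {w} → w < 4 →
    m % 4 ≡ (p ℕ.* p ℕ.+ q ℕ.* q) % 4 → m % 4 ≡ (s ℕ.* s ℕ.+ 3 ℕ.* (w ℕ.* w)) % 4 → m ≡ 0 ⊎ m ≡ 1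
  check = from-yes (allUpTo? (λ m → allUpTo? (λ p → allUpTo? (λ q → allUpTo? (λ s → allUpTo? (λ w →
    m % 4 ≟ (p ℕ.* p ℕ.+ q ℕ.* q) % 4 →-dec m % 4 ≟ (s ℕ.* s ℕ.+ 3 ℕ.* (w ℕ.* w)) % 4 →-dec
    (m ≟ 0 ⊎-dec m ≟ 1))
    4) 4) 4) 4) 4)

square-*-mod-4 : ∀ h m → m %ℕ 4 ≡ 0 ⊎ m %ℕ 4 ≡ 1 → h * h * m %ℕ 4 ≡ 0 ⊎ h * h * m %ℕ 4 ≡ 1
square-*-mod-4 h m m≡0,1 = subst (λ r → r ≡ 0 ⊎ r ≡ 1) (sym (residue (⌊ h ⌋ ⊗ ⌊ h ⌋ ⊗ ⌊ m ⌋)))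
  (check (n%ℕd<d h 4) (n%ℕd<d m 4) m≡0,1)
  where
  open Mod4
  check : ∀ {h} → h < 4 → ∀ {m} → m < 4 →
    m ≡ 0 ⊎ m ≡ 1 → h ℕ.* h ℕ.* m % 4 ≡ 0 ⊎ h ℕ.* h ℕ.* m % 4 ≡ 1
  check = from-yes (allUpTo? (λ h → allUpTo? (λ m →
    (m ≟ 0 ⊎-dec m ≟ 1) →-dec (h ℕ.* h ℕ.* m % 4 ≟ 0 ⊎-dec h ℕ.* h ℕ.* m % 4 ≟ 1)) 4) 4)

x²-xy+y²-mod-4 : ∀ {x y} → Coprime x y → x²-xy+y² x y %ℕ 4 ≡ 1 ⊎ x²-xy+y² x y %ℕ 4 ≡ 3
x²-xy+y²-mod-4 {x} {y} (bézout u v identity) =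
  check (n%ℕd<d u 4) (n%ℕd<d v 4) (n%ℕd<d x 4) (n%ℕd<d y 4) (n%ℕd<d e 4)
    (≈-≡ identity (⌊ u ⌋ ⊗ ⌊ x ⌋ ⊕ ⌊ v ⌋ ⊗ ⌊ y ⌋) (‵ 1))
    (≈-≡ (add-xy x y) (⌊ e ⌋ ⊕ ⌊ x ⌋ ⊗ ⌊ y ⌋) (⌊ x ⌋ ⊗ ⌊ x ⌋ ⊕ ⌊ y ⌋ ⊗ ⌊ y ⌋))
  where
  open Mod4
  e = x²-xy+y² x y
  add-xy : ∀ x y → x * x - x * y + y * y + x * y ≡ x * x + y * y
  add-xy = solve-∀
  check : ∀ {u} → u < 4 → ∀ {v} → v < 4 → ∀ {x} → x < 4 → ∀ {y} → y < 4 → ∀ {e} → e < 4 →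
    (u ℕ.* x ℕ.+ v ℕ.* y) % 4 ≡ 1 → (e ℕ.+ x ℕ.* y) % 4 ≡ (x ℕ.* x ℕ.+ y ℕ.* y) % 4 → e ≡ 1 ⊎ e ≡ 3
  check = from-yes (allUpTo? (λ u → allUpTo? (λ v → allUpTo? (λ x → allUpTo? (λ y → allUpTo? (λ e →
    (u ℕ.* x ℕ.+ v ℕ.* y) % 4 ≟ 1 →-dec (e ℕ.+ x ℕ.* y) % 4 ≟ (x ℕ.* x ℕ.+ y ℕ.* y) % 4 →-dec
    (e ≟ 1 ⊎-dec e ≟ 3))
    4) 4) 4) 4) 4)

2e≡g²m⇒m≡2-mod-4 : ∀ e g m → e %ℕ 4 ≡ 1 ⊎ e %ℕ 4 ≡ 3 → + 2 * e ≡ g * g * m → m %ℕ 4 ≡ 2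
2e≡g²m⇒m≡2-mod-4 e g m e-odd 2e≡g²m = check (n%ℕd<d e 4) (n%ℕd<d g 4) (n%ℕd<d m 4) e-odd
  (≈-≡ 2e≡g²m (‵ 2 ⊗ ⌊ e ⌋) (⌊ g ⌋ ⊗ ⌊ g ⌋ ⊗ ⌊ m ⌋))
  where
  open Mod4
  check : ∀ {e} → e < 4 → ∀ {g} → g < 4 → ∀ {m} → m < 4 →
    e ≡ 1 ⊎ e ≡ 3 → 2 ℕ.* e % 4 ≡ g ℕ.* g ℕ.* m % 4 → m ≡ 2
  check = from-yes (allUpTo? (λ e → allUpTo? (λ g → allUpTo? (λ m →
    (e ≟ 1 ⊎-dec e ≟ 3) →-dec 2 ℕ.* e % 4 ≟ g ℕ.* g ℕ.* m % 4 →-dec m ≟ 2) 4) 4) 4)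

3∣y²⇒3∣y : ∀ y z → y * y ≡ + 3 * z → y %ℕ 3 ≡ 0
3∣y²⇒3∣y y z y²≡3z = check (n%ℕd<d y 3) (n%ℕd<d z 3) (≈-≡ y²≡3z (⌊ y ⌋ ⊗ ⌊ y ⌋) (‵ 3 ⊗ ⌊ z ⌋))
  where
  open Mod3
  check : ∀ {y} → y < 3 → ∀ {z} → z < 3 → y ℕ.* y % 3 ≡ 3 ℕ.* z % 3 → y ≡ 0
  check = from-yes (allUpTo? (λ y → allUpTo? (λ z → y ℕ.* y % 3 ≟ 3 ℕ.* z % 3 →-dec y ≟ 0) 3) 3)

unit-square-mod-3 : ∀ {x} → Coprime x (+ 3) → ∀ c z → c ≡ x * x + + 3 * z → c %ℕ 3 ≡ 1
unit-square-mod-3 {x} (bézout u v identity) c z c≡x²+3z =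
  check (n%ℕd<d u 3) (n%ℕd<d v 3) (n%ℕd<d x 3) (n%ℕd<d c 3) (n%ℕd<d z 3)
    (≈-≡ identity (⌊ u ⌋ ⊗ ⌊ x ⌋ ⊕ ⌊ v ⌋ ⊗ ‵ 3) (‵ 1))
    (≈-≡ c≡x²+3z ⌊ c ⌋ (⌊ x ⌋ ⊗ ⌊ x ⌋ ⊕ ‵ 3 ⊗ ⌊ z ⌋))
  where
  open Mod3
  check : ∀ {u} → u < 3 → ∀ {v} → v < 3 → ∀ {x} → x < 3 → ∀ {c} → c < 3 → ∀ {z} → z < 3 →
    (u ℕ.* x ℕ.+ v ℕ.* 3) % 3 ≡ 1 → c % 3 ≡ (x ℕ.* x ℕ.+ 3 ℕ.* z) % 3 → c ≡ 1
  check = from-yes (allUpTo? (λ u → allUpTo? (λ v → allUpTo? (λ x → allUpTo? (λ c → allUpTo? (λ z →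
    (u ℕ.* x ℕ.+ v ℕ.* 3) % 3 ≟ 1 →-dec c % 3 ≟ (x ℕ.* x ℕ.+ 3 ℕ.* z) % 3 →-dec c ≟ 1) 3) 3) 3) 3) 3)

2h²c≡1⇒g²c≢1-mod-3 : ∀ h g c → + 2 * (h * h * c) %ℕ 3 ≡ 1 → g * g * c %ℕ 3 ≢ 1
2h²c≡1⇒g²c≢1-mod-3 h g c 2h²c≡1 g²c≡1 = check (n%ℕd<d h 3) (n%ℕd<d g 3) (n%ℕd<d c 3)
  (trans (sym (residue (‵ 2 ⊗ (⌊ h ⌋ ⊗ ⌊ h ⌋ ⊗ ⌊ c ⌋)))) 2h²c≡1)
  (trans (sym (residue (⌊ g ⌋ ⊗ ⌊ g ⌋ ⊗ ⌊ c ⌋))) g²c≡1)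
  where
  open Mod3
  check : ∀ {h} → h < 3 → ∀ {g} → g < 3 → ∀ {c} → c < 3 →
    2 ℕ.* (h ℕ.* h ℕ.* c) % 3 ≡ 1 → g ℕ.* g ℕ.* c % 3 ≢ 1
  check = from-yes (allUpTo? (λ h → allUpTo? (λ g → allUpTo? (λ c →
    2 ℕ.* (h ℕ.* h ℕ.* c) % 3 ≟ 1 →-dec ¬? (g ℕ.* g ℕ.* c % 3 ≟ 1)) 3) 3) 3)

-- Primitive parts and common cofactors

record GcdFactorisation (x y : ℤ) : Set where
  field
    g x₀ y₀ : ℤ
    x≡gx₀ : x ≡ g * x₀
    y≡gy₀ : y ≡ g * y₀
    coprime : Coprime x₀ y₀

module _ where
  open GcdFactorisation
  open Bézout using (lemma; result; Identity; +-; -+)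

  private
    cancel-gcd : ∀ {d p q a b} .{{_ : NonZero d}} →
                 d ℕ.+ b ℕ.* (q ℕ.* d) ≡ a ℕ.* (p ℕ.* d) → 1 ℕ.+ b ℕ.* q ≡ a ℕ.* p
    cancel-gcd {d} {p} {q} {a} {b} eq =
      ℕₚ.*-cancelʳ-≡ _ _ d (trans (factor d b q) (trans eq (sym (ℕₚ.*-assoc a p d))))
      where
      factor : ∀ d b q → (1 ℕ.+ b ℕ.* q) ℕ.* d ≡ d ℕ.+ b ℕ.* (q ℕ.* d)
      factor = ℕ-solve-∀

    bézout-ℤ : ∀ {a p b q} → 1 ℕ.+ b ℕ.* q ≡ a ℕ.* p → Coprime (+ p) (+ q)
    bézout-ℤ {a} {p} {b} {q} eq = bézout (+ a) (- + b) (begin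
      + a * + p + - + b * + q              ≡⟨ cong (_+ - + b * + q) (ℤₚ.pos-* a p) ⟨
      + (a ℕ.* p) + - + b * + q            ≡⟨ cong (λ z → + z + - + b * + q) eq ⟨
      + (1 ℕ.+ b ℕ.* q) + - + b * + q      ≡⟨ cong (_+ - + b * + q) (ℤₚ.pos-+ 1 (b ℕ.* q)) ⟩
      1ℤ + + (b ℕ.* q) + - + b * + q       ≡⟨ cong (λ z → 1ℤ + z + - + b * + q) (ℤₚ.pos-* b q) ⟩
      1ℤ + + b * + q + - + b * + q         ≡⟨ cancel (+ b) (+ q) ⟩
      1ℤ                                   ∎)
      where
      open ≡-Reasoning
      cancel : ∀ b q → 1ℤ + b * q + - b * q ≡ 1ℤ
      cancel = solve-∀

    swap : ∀ {x y} → Coprime x y → Coprime y x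
    swap (bézout u v identity) = bézout v u (trans (ℤₚ.+-comm (v * _) (u * _)) identity)

    +≡+* : ∀ {m p d} → m ≡ p ℕ.* d → + m ≡ + d * + p
    +≡+* {m} {p} {d} refl = trans (cong +_ (ℕₚ.*-comm p d)) (ℤₚ.pos-* d p)

    cofactors-coprime : ∀ {d m n p q} .{{_ : NonZero d}} → m ≡ p ℕ.* d → n ≡ q ℕ.* d →
                        Identity d m n → Coprime (+ p) (+ q)
    cofactors-coprime {d} {p = p} {q} refl refl (+- a b eq) = bézout-ℤ {a} {p} {b} {q} (cancel-gcd {d} {p} {q} {a} {b} eq)
    cofactors-coprime {d} {p = p} {q} refl refl (-+ a b eq) =
      swap (bézout-ℤ {b} {q} {a} {p} (cancel-gcd {d} {q} {p} {b} {a} eq))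

  gcdFactorisationℕ : ∀ m n → GcdFactorisation (+ m) (+ n)
  gcdFactorisationℕ m n with lemma m n
  ... | result zero gcd _ = record
    { g = 0ℤ ; x₀ = 1ℤ ; y₀ = 0ℤ
    ; x≡gx₀ = cong +_ (0∣⇒≡0 (proj₁ (GCD.commonDivisor gcd)))
    ; y≡gy₀ = cong +_ (0∣⇒≡0 (proj₂ (GCD.commonDivisor gcd)))
    ; coprime = bézout 1ℤ 0ℤ refl
    }
  ... | result d@(suc _) gcd identity with GCD.commonDivisor gcd
  ...   | divides p m≡pd , divides q n≡qd = record
    { g = + d ; x₀ = + p ; y₀ = + q
    ; x≡gx₀ = +≡+* {m} {p} {d} m≡pd
    ; y≡gy₀ = +≡+* {n} {q} {d} n≡qd
    ; coprime = cofactors-coprime {d} {m} {n} {p} {q} m≡pd n≡qd identity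
    }

  negateˡ : ∀ {x y} → GcdFactorisation x y → GcdFactorisation (- x) y
  negateˡ F = record
    { g = g F ; x₀ = - x₀ F ; y₀ = y₀ F
    ; x≡gx₀ = trans (cong -_ (x≡gx₀ F)) (ℤₚ.neg-distribʳ-* (g F) (x₀ F))
    ; y≡gy₀ = y≡gy₀ F
    ; coprime = bézout (- u) v (trans (neg-neg u (x₀ F) (v * y₀ F)) identity)
    }
    where
    open Coprime (coprime F)
    neg-neg : ∀ u x w → - u * - x + w ≡ u * x + w
    neg-neg = solve-∀

  negateʳ : ∀ {x y} → GcdFactorisation x y → GcdFactorisation x (- y)
  negateʳ F = record
    { g = g F ; x₀ = x₀ F ; y₀ = - y₀ F
    ; x≡gx₀ = x≡gx₀ F
    ; y≡gy₀ = trans (cong -_ (y≡gy₀ F)) (ℤₚ.neg-distribʳ-* (g F) (y₀ F))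
    ; coprime = bézout u (- v) (trans (neg-neg (u * x₀ F) v (y₀ F)) identity)
    }
    where
    open Coprime (coprime F)
    neg-neg : ∀ w v y → w + - v * - y ≡ w + v * y
    neg-neg = solve-∀

gcdFactorisation : ∀ x y → GcdFactorisation x y
gcdFactorisation (+ m) (+ n) = gcdFactorisationℕ m n
gcdFactorisation (+ m) -[1+ n ] = negateʳ (gcdFactorisationℕ m (suc n))
gcdFactorisation -[1+ m ] (+ n) = negateˡ (gcdFactorisationℕ (suc m) n)
gcdFactorisation -[1+ m ] -[1+ n ] = negateˡ (negateʳ (gcdFactorisationℕ (suc m) (suc n)))

Homogeneous : (ℤ → ℤ → ℤ) → Set
Homogeneous Q = ∀ g x y → Q (g * x) (g * y) ≡ g * g * Q x y

3x²-y²-homogeneous : Homogeneous 3x²-y²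
3x²-y²-homogeneous = homogeneous
  where
  homogeneous : ∀ g x y → + 3 * ((g * x) * (g * x)) - (g * y) * (g * y) ≡ g * g * (+ 3 * (x * x) - y * y)
  homogeneous = solve-∀

x²+y²-homogeneous : Homogeneous x²+y²
x²+y²-homogeneous = homogeneous
  where
  homogeneous : ∀ g x y → (g * x) * (g * x) + (g * y) * (g * y) ≡ g * g * (x * x + y * y)
  homogeneous = solve-∀

2[x²-xy+y²]-homogeneous : Homogeneous 2[x²-xy+y²]
2[x²-xy+y²]-homogeneous = homogeneous
  where
  homogeneous : ∀ g x y → + 2 * ((g * x) * (g * x) - (g * x) * (g * y) + (g * y) * (g * y))
                        ≡ g * g * (+ 2 * (x * x - x * y + y * y))
  homogeneous = solve-∀

factor-out : ∀ Q → Homogeneous Q → ∀ {x y} (F : GcdFactorisation x y) →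
             let open GcdFactorisation F in Q x y ≡ g * g * Q x₀ y₀
factor-out Q homogeneous F = trans (cong₂ Q x≡gx₀ y≡gy₀) (homogeneous g x₀ y₀)
  where open GcdFactorisation F

-- The cube of the Bézout identity.
squares-coprime : ∀ {g h} → Coprime g h → Coprime (g * g) (h * h)
squares-coprime {g} {h} (bézout c e identity) = bézout α β (begin
  α * (g * g) + β * (h * h)                            ≡⟨ cube c e g h ⟩
  (c * g + e * h) * (c * g + e * h) * (c * g + e * h)  ≡⟨ cong (λ z → z * z * z) identity ⟩
  1ℤ                                                   ∎)
  where
  open ≡-Reasoning
  α = c * c * c * g + + 3 * (c * c) * e * h
  β = + 3 * c * (e * e) * g + e * e * e * h
  cube : ∀ c e g h → (c * c * c * g + + 3 * (c * c) * e * h) * (g * g)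
                     + (+ 3 * c * (e * e) * g + e * e * e * h) * (h * h)
                     ≡ (c * g + e * h) * (c * g + e * h) * (c * g + e * h)
  cube = solve-∀

coprime-cofactor : ∀ {G H} → Coprime G H → ∀ A B → G * A ≡ H * B → ∃ λ M → A ≡ H * M × B ≡ G * M
coprime-cofactor {G} {H} (bézout α β identity) A B GA≡HB = α * B + β * A , (begin
  A                             ≡⟨ times-identity A ⟩
  A * (α * G + β * H)           ≡⟨ expandᴬ α β G H A ⟩
  α * (G * A) + β * H * A       ≡⟨ cong (λ z → α * z + β * H * A) GA≡HB ⟩
  α * (H * B) + β * H * A       ≡⟨ collectᴬ α β H A B ⟩
  H * (α * B + β * A)           ∎) , (begin
  B                             ≡⟨ times-identity B ⟩
  B * (α * G + β * H)           ≡⟨ expandᴮ α β G H B ⟩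
  α * G * B + β * (H * B)       ≡⟨ cong (λ z → α * G * B + β * z) GA≡HB ⟨
  α * G * B + β * (G * A)       ≡⟨ collectᴮ α β G A B ⟩
  G * (α * B + β * A)           ∎)
  where
  open ≡-Reasoning
  times-identity : ∀ X → X ≡ X * (α * G + β * H)
  times-identity X = trans (sym (ℤₚ.*-identityʳ X)) (cong (X *_) (sym identity))
  expandᴬ : ∀ α β G H A → A * (α * G + β * H) ≡ α * (G * A) + β * H * A
  expandᴬ = solve-∀
  collectᴬ : ∀ α β H A B → α * (H * B) + β * H * A ≡ H * (α * B + β * A)
  collectᴬ = solve-∀
  expandᴮ : ∀ α β G H B → B * (α * G + β * H) ≡ α * G * B + β * (H * B)
  expandᴮ = solve-∀
  collectᴮ : ∀ α β G A B → α * G * B + β * (G * A) ≡ G * (α * B + β * A)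
  collectᴮ = solve-∀

record CommonCofactor (t A B : ℤ) : Set where
  field
    m s g h : ℤ
    t≡s²m : t ≡ s * s * m
    A≡h²m : A ≡ h * h * m
    B≡g²m : B ≡ g * g * m

common-cofactor : ∀ {t} g₁ g₂ A B → t ≡ g₁ * g₁ * A → t ≡ g₂ * g₂ * B → t ≢ 0ℤ →
                  CommonCofactor t A B
common-cofactor {t} g₁ g₂ A B t≡g₁²A t≡g₂²B t≢0 = record
  { m = M ; s = d * g * h ; g = g ; h = h
  ; t≡s²m = begin
      t                              ≡⟨ t≡d²g²A ⟩
      d * d * (g * g * A)            ≡⟨ cong (λ z → d * d * (g * g * z)) A≡h²M ⟩
      d * d * (g * g * (h * h * M))  ≡⟨ regroup d g h M ⟩
      d * g * h * (d * g * h) * M    ∎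
  ; A≡h²m = A≡h²M
  ; B≡g²m = B≡g²M
  }
  where
  open ≡-Reasoning
  open GcdFactorisation (gcdFactorisation g₁ g₂) renaming (g to d; x₀ to g; y₀ to h)
  pull : ∀ d g X → (d * g) * (d * g) * X ≡ d * d * (g * g * X)
  pull = solve-∀
  regroup : ∀ d g h M → d * d * (g * g * (h * h * M)) ≡ d * g * h * (d * g * h) * M
  regroup = solve-∀
  t≡d²g²A : t ≡ d * d * (g * g * A)
  t≡d²g²A = trans t≡g₁²A (trans (cong (λ z → z * z * A) x≡gx₀) (pull d g A))
  t≡d²h²B : t ≡ d * d * (h * h * B)
  t≡d²h²B = trans t≡g₂²B (trans (cong (λ z → z * z * B) y≡gy₀) (pull d h B))
  d≢0 : d ≢ 0ℤ
  d≢0 d≡0 = t≢0 (trans t≡d²g²A (cong (λ z → z * z * (g * g * A)) d≡0))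
  g²A≡h²B : g * g * A ≡ h * h * B
  g²A≡h²B = ℤₚ.*-cancelˡ-≡ (d * d) _ _ {{ℤₚ.i*j≢0 d d {{ℤ.≢-nonZero d≢0}} {{ℤ.≢-nonZero d≢0}}}}
              (trans (sym t≡d²g²A) t≡d²h²B)
  cofactor = coprime-cofactor (squares-coprime coprime) A B g²A≡h²B
  M = proj₁ cofactor
  A≡h²M : A ≡ h * h * M
  A≡h²M = proj₁ (proj₂ cofactor)
  B≡g²M : B ≡ g * g * M
  B≡g²M = proj₂ (proj₂ cofactor)

-- Square roots modulo n

infix 4 √_mod_

record √_mod_ (a n : ℤ) : Set where
  constructor mk√
  field
    r k : ℤ
    r²≡a+nk : r * r ≡ a + n * k

√-mod-divisor : ∀ {a N} m n → N ≡ m * n → √ a mod N → √ a mod n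
√-mod-divisor {a} m n refl (mk√ r k r²≡) = mk√ r (m * k) (trans r²≡ (cong (_+_ a) (regroup m n k)))
  where
  regroup : ∀ m n k → m * n * k ≡ n * (m * k)
  regroup = solve-∀

√-* : ∀ {a b n} → √ a mod n → √ b mod n → √ (a * b) mod n
√-* {a} {b} {n} (mk√ q k q²≡) (mk√ r l r²≡) = mk√ (q * r) (a * l + k * b + n * k * l) (begin
  q * r * (q * r)                         ≡⟨ regroup q r ⟩
  q * q * (r * r)                         ≡⟨ cong₂ _*_ q²≡ r²≡ ⟩
  (a + n * k) * (b + n * l)               ≡⟨ expand a b n k l ⟩
  a * b + n * (a * l + k * b + n * k * l) ∎)
  where
  open ≡-Reasoning
  regroup : ∀ q r → q * r * (q * r) ≡ q * q * (r * r)
  regroup = solve-∀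
  expand : ∀ a b n k l → (a + n * k) * (b + n * l) ≡ a * b + n * (a * l + k * b + n * k * l)
  expand = solve-∀

√-cancel : ∀ {c n} → Coprime c n → ∀ a → √ (c * c * a) mod n → √ a mod n
√-cancel {c} {n} (bézout γ δ identity) a (mk√ q k q²≡) = mk√ (γ * q) K (begin
  γ * q * (γ * q)                                     ≡⟨ regroup γ q ⟩
  γ * γ * (q * q)                                     ≡⟨ cong (γ * γ *_) q²≡ ⟩
  γ * γ * (c * c * a + n * k)                         ≡⟨ complete c γ δ a n k ⟩
  (γ * c + δ * n) * (γ * c + δ * n) * a + n * K       ≡⟨ cong (λ z → z * z * a + n * K) identity ⟩
  1ℤ * 1ℤ * a + n * K                                 ≡⟨ cong (_+ n * K) (ℤₚ.*-identityˡ a) ⟩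
  a + n * K                                           ∎)
  where
  open ≡-Reasoning
  K = γ * γ * k - a * δ * (+ 2 * c * γ + n * δ)
  regroup : ∀ γ q → γ * q * (γ * q) ≡ γ * γ * (q * q)
  regroup = solve-∀
  complete : ∀ c γ δ a n k → γ * γ * (c * c * a + n * k)
             ≡ (γ * c + δ * n) * (γ * c + δ * n) * a + n * (γ * γ * k - a * δ * (+ 2 * c * γ + n * δ))
  complete = solve-∀

-- Each root is √D · (u x + v y), computed in the quadratic ring in which (x, y)
-- has norm 3x² - y², x² + y² or x² - xy + y²; each `norm` identity is the
-- multiplicativity of that norm.
√3-mod-3x²-y² : ∀ {x y} → Coprime x y → √ + 3 mod 3x²-y² x y
√3-mod-3x²-y² {x} {y} (bézout u v identity) = mk√ (u * y + + 3 * v * x) k (begin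
  (u * y + + 3 * v * x) * (u * y + + 3 * v * x)                    ≡⟨ norm u v x y ⟩
  + 3 * ((u * x + v * y) * (u * x + v * y)) + 3x²-y² x y * k
    ≡⟨ cong (λ z → + 3 * (z * z) + 3x²-y² x y * k) identity ⟩
  + 3 + 3x²-y² x y * k                                             ∎)
  where
  open ≡-Reasoning
  k = + 3 * (v * v) - u * u
  norm : ∀ u v x y → (u * y + + 3 * v * x) * (u * y + + 3 * v * x)
         ≡ + 3 * ((u * x + v * y) * (u * x + v * y)) + (+ 3 * (x * x) - y * y) * (+ 3 * (v * v) - u * u)
  norm = solve-∀

√-1-mod-x²+y² : ∀ {x y} → Coprime x y → √ -1ℤ mod x²+y² x y
√-1-mod-x²+y² {x} {y} (bézout u v identity) = mk√ (u * y - v * x) k (begin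
  (u * y - v * x) * (u * y - v * x)                               ≡⟨ norm u v x y ⟩
  - ((u * x + v * y) * (u * x + v * y)) + x²+y² x y * k
    ≡⟨ cong (λ z → - (z * z) + x²+y² x y * k) identity ⟩
  -1ℤ + x²+y² x y * k                                             ∎)
  where
  open ≡-Reasoning
  k = u * u + v * v
  norm : ∀ u v x y → (u * y - v * x) * (u * y - v * x)
         ≡ - ((u * x + v * y) * (u * x + v * y)) + (x * x + y * y) * (u * u + v * v)
  norm = solve-∀

√-3-mod-x²-xy+y² : ∀ {x y} → Coprime x y → √ - + 3 mod x²-xy+y² x y
√-3-mod-x²-xy+y² {x} {y} (bézout u v identity) = mk√ q k (begin
  q * q                                                            ≡⟨ norm u v x y ⟩
  - (+ 3 * ((u * x + v * y) * (u * x + v * y))) + x²-xy+y² x y * k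
    ≡⟨ cong (λ z → - (+ 3 * (z * z)) + x²-xy+y² x y * k) identity ⟩
  - + 3 + x²-xy+y² x y * k                                         ∎)
  where
  open ≡-Reasoning
  q = u * (x - + 2 * y) + v * (+ 2 * x - y)
  k = + 4 * (u * u + u * v + v * v)
  norm : ∀ u v x y → (u * (x - + 2 * y) + v * (+ 2 * x - y)) * (u * (x - + 2 * y) + v * (+ 2 * x - y))
         ≡ - (+ 3 * ((u * x + v * y) * (u * x + v * y))) + (x * x - x * y + y * y) * (+ 4 * (u * u + u * v + v * v))
  norm = solve-∀

3x²-y²≡3c⇒c≡1-mod-3 : ∀ {x y} → Coprime x y → ∀ c → 3x²-y² x y ≡ + 3 * c → c %ℕ 3 ≡ 1
3x²-y²≡3c⇒c≡1-mod-3 {x} {y} (bézout u v identity) c t≡3c =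
  unit-square-mod-3 x-coprime-3 c (- (j * j)) c≡x²-3j²
  where
  open ≡-Reasoning
  j = y /ℕ 3
  y²≡3[x²-c] : y * y ≡ + 3 * (x * x - c)
  y²≡3[x²-c] = begin
    y * y                          ≡⟨ solve-y x y ⟩
    + 3 * (x * x) - 3x²-y² x y     ≡⟨ cong (λ z → + 3 * (x * x) - z) t≡3c ⟩
    + 3 * (x * x) - + 3 * c        ≡⟨ factor x c ⟩
    + 3 * (x * x - c)              ∎
    where
    solve-y : ∀ x y → y * y ≡ + 3 * (x * x) - (+ 3 * (x * x) - y * y)
    solve-y = solve-∀
    factor : ∀ x c → + 3 * (x * x) - + 3 * c ≡ + 3 * (x * x - c)
    factor = solve-∀
  y≡3j : y ≡ + 0 + j * + 3
  y≡3j = Mod3.divMod y (3∣y²⇒3∣y y (x * x - c) y²≡3[x²-c])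
  c≡x²-3j² : c ≡ x * x + + 3 * - (j * j)
  c≡x²-3j² = ℤₚ.*-cancelˡ-≡ (+ 3) _ _ (begin
    + 3 * c                                              ≡⟨ t≡3c ⟨
    + 3 * (x * x) - y * y                                ≡⟨ cong (λ z → + 3 * (x * x) - z * z) y≡3j ⟩
    + 3 * (x * x) - (+ 0 + j * + 3) * (+ 0 + j * + 3)    ≡⟨ expand x j ⟩
    + 3 * (x * x + + 3 * - (j * j))                      ∎)
    where
    expand : ∀ x j → + 3 * (x * x) - (+ 0 + j * + 3) * (+ 0 + j * + 3) ≡ + 3 * (x * x + + 3 * - (j * j))
    expand = solve-∀
  x-coprime-3 : Coprime x (+ 3)
  x-coprime-3 = bézout u (v * j) (trans (regroup u x v j) (trans (cong (λ z → u * x + v * z) (sym y≡3j)) identity))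
    where
    regroup : ∀ u x v j → u * x + v * j * + 3 ≡ u * x + v * (+ 0 + j * + 3)
    regroup = solve-∀

x²-xy+y²≡3c⇒c≡1-mod-3 : ∀ {x y} → Coprime x y → ∀ c → x²-xy+y² x y ≡ + 3 * c → c %ℕ 3 ≡ 1
x²-xy+y²≡3c⇒c≡1-mod-3 {x} {y} (bézout u v identity) c e≡3c =
  unit-square-mod-3 y-coprime-3 c (l * l - l * y) c≡y²+3[l²-ly]
  where
  open ≡-Reasoning
  l = (x + y) /ℕ 3
  [x+y]²≡3[c+xy] : (x + y) * (x + y) ≡ + 3 * (c + x * y)
  [x+y]²≡3[c+xy] = begin
    (x + y) * (x + y)                ≡⟨ expand x y ⟩
    x²-xy+y² x y + + 3 * (x * y)     ≡⟨ cong (_+ + 3 * (x * y)) e≡3c ⟩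
    + 3 * c + + 3 * (x * y)          ≡⟨ ℤₚ.*-distribˡ-+ (+ 3) c (x * y) ⟨
    + 3 * (c + x * y)                ∎
    where
    expand : ∀ x y → (x + y) * (x + y) ≡ x * x - x * y + y * y + + 3 * (x * y)
    expand = solve-∀
  x+y≡3l : x + y ≡ + 0 + l * + 3
  x+y≡3l = Mod3.divMod (x + y) (3∣y²⇒3∣y (x + y) (c + x * y) [x+y]²≡3[c+xy])
  c≡y²+3[l²-ly] : c ≡ y * y + + 3 * (l * l - l * y)
  c≡y²+3[l²-ly] = ℤₚ.*-cancelˡ-≡ (+ 3) _ _ (begin
    + 3 * c                                                              ≡⟨ e≡3c ⟨
    x²-xy+y² x y                                                         ≡⟨ in-terms-of-sum x y ⟩
    (x + y) * (x + y) - + 3 * ((x + y) * y) + + 3 * (y * y)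
      ≡⟨ cong (λ s → s * s - + 3 * (s * y) + + 3 * (y * y)) x+y≡3l ⟩
    s₃ * s₃ - + 3 * (s₃ * y) + + 3 * (y * y)                             ≡⟨ expand l y ⟩
    + 3 * (y * y + + 3 * (l * l - l * y))                                ∎)
    where
    s₃ = + 0 + l * + 3
    in-terms-of-sum : ∀ x y → x * x - x * y + y * y ≡ (x + y) * (x + y) - + 3 * ((x + y) * y) + + 3 * (y * y)
    in-terms-of-sum = solve-∀
    expand : ∀ l y → (+ 0 + l * + 3) * (+ 0 + l * + 3) - + 3 * ((+ 0 + l * + 3) * y) + + 3 * (y * y)
                     ≡ + 3 * (y * y + + 3 * (l * l - l * y))
    expand = solve-∀
  y-coprime-3 : Coprime y (+ 3)
  y-coprime-3 = bézout (v - u) (u * l) (begin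
    (v - u) * y + u * l * + 3            ≡⟨ regroup u v y l ⟩
    u * (+ 0 + l * + 3) - u * y + v * y  ≡⟨ cong (λ s → u * s - u * y + v * y) x+y≡3l ⟨
    u * (x + y) - u * y + v * y          ≡⟨ cancel u v x y ⟩
    u * x + v * y                        ≡⟨ identity ⟩
    1ℤ                                   ∎)
    where
    regroup : ∀ u v y l → (v - u) * y + u * l * + 3 ≡ u * (+ 0 + l * + 3) - u * y + v * y
    regroup = solve-∀
    cancel : ∀ u v x y → u * (x + y) - u * y + v * y ≡ u * x + v * y
    cancel = solve-∀

unit-mod-3 : ∀ m → m %ℕ 3 ≢ 0 → Coprime (+ 3) m
unit-mod-3 m m≢0 with m %ℕ 3 in m%3 | n%ℕd<d m 3
... | 0 | _ = ⊥-elim (m≢0 refl)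
... | 1 | _ = bézout (- κ) 1ℤ (trans (cong (λ z → - κ * + 3 + 1ℤ * z) (Mod3.divMod m m%3)) (inverse κ))
  where
  κ = m /ℕ 3
  inverse : ∀ κ → - κ * + 3 + 1ℤ * (+ 1 + κ * + 3) ≡ 1ℤ
  inverse = solve-∀
... | 2 | _ = bézout (κ + 1ℤ) -1ℤ
  (trans (cong (λ z → (κ + 1ℤ) * + 3 + -1ℤ * z) (Mod3.divMod m m%3)) (inverse κ))
  where
  κ = m /ℕ 3
  inverse : ∀ κ → (κ + 1ℤ) * + 3 + -1ℤ * (+ 2 + κ * + 3) ≡ 1ℤ
  inverse = solve-∀
... | suc (suc (suc _)) | s≤s (s≤s (s≤s ()))

-- If m = 3κ, the two cofactors of 3 give 2h²κ ≡ 1 and g²κ ≡ 1 modulo 3, which is impossible.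
3∤common-cofactor : ∀ {x y x′ y′} → Coprime x y → Coprime x′ y′ → ∀ h g m →
                    3x²-y² x y ≡ h * h * (+ 2 * m) → x²-xy+y² x′ y′ ≡ g * g * m → m %ℕ 3 ≢ 0
3∤common-cofactor {x} {y} {x′} {y′} coprime coprime′ h g m t≡h²2m e≡g²m m≡0 =
  2h²c≡1⇒g²c≢1-mod-3 h g κ
    (3x²-y²≡3c⇒c≡1-mod-3 coprime (+ 2 * (h * h * κ))
      (trans t≡h²2m (trans (cong (λ z → h * h * (+ 2 * z)) m≡3κ) (pull-3ᵗ h κ))))
    (x²-xy+y²≡3c⇒c≡1-mod-3 coprime′ (g * g * κ)
      (trans e≡g²m (trans (cong (λ z → g * g * z) m≡3κ) (pull-3ᵉ g κ))))
  where
  κ = m /ℕ 3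
  m≡3κ : m ≡ + 0 + κ * + 3
  m≡3κ = Mod3.divMod m m≡0
  pull-3ᵗ : ∀ h κ → h * h * (+ 2 * (+ 0 + κ * + 3)) ≡ + 3 * (+ 2 * (h * h * κ))
  pull-3ᵗ = solve-∀
  pull-3ᵉ : ∀ g κ → g * g * (+ 0 + κ * + 3) ≡ + 3 * (g * g * κ)
  pull-3ᵉ = solve-∀

square-ℕ : ∀ x → x * x ≡ + (∣ x ∣ ℕ.* ∣ x ∣)
square-ℕ (+ n) = sym (ℤₚ.pos-* n n)
square-ℕ -[1+ n ] = refl

positive-factor : ∀ m i {n} → + m * i ≡ + suc n → ∃ λ k → i ≡ + suc k
positive-factor m (+ zero) eq = ⊥-elim (ℕₚ.0≢1+n (ℤₚ.+-injective (trans (sym (ℤₚ.*-zeroʳ (+ m))) eq)))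
positive-factor m (+ suc k) _ = k , refl
positive-factor zero -[1+ k ] ()
positive-factor (suc m) -[1+ k ] ()

nonNegative-factor : ∀ m i {n} → + suc m * i ≡ + n → ∃ λ k → i ≡ + k
nonNegative-factor m (+ k) _ = k , refl
nonNegative-factor m -[1+ k ] ()

square-*-positive : ∀ s m {N} → s * s * m ≡ + suc N → ∃ λ k → m ≡ + suc k
square-*-positive s m eq = positive-factor (∣ s ∣ ℕ.* ∣ s ∣) m (trans (cong (_* m) (sym (square-ℕ s))) eq)

x²+y²-nonNegative : ∀ a b → ∃ λ K → x²+y² a b ≡ + K
x²+y²-nonNegative a b =
  _ , trans (cong₂ _+_ (square-ℕ a) (square-ℕ b)) (sym (ℤₚ.pos-+ (∣ a ∣ ℕ.* ∣ a ∣) (∣ b ∣ ℕ.* ∣ b ∣)))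

2[x²-xy+y²]-nonNegative : ∀ x y → ∃ λ K → 2[x²-xy+y²] x y ≡ + K
2[x²-xy+y²]-nonNegative x y = _ , trans (cong (+ 2 *_) (proj₂ e≥0)) (sym (ℤₚ.pos-* 2 (proj₁ e≥0)))
  where
  z = + 2 * x - y
  Z² = ∣ z ∣ ℕ.* ∣ z ∣
  Y² = ∣ y ∣ ℕ.* ∣ y ∣
  four-times : ∀ x y → + 4 * (x * x - x * y + y * y) ≡ (+ 2 * x - y) * (+ 2 * x - y) + + 3 * (y * y)
  four-times = solve-∀
  e≥0 = nonNegative-factor 3 (x²-xy+y² x y) (begin
    + 4 * x²-xy+y² x y                    ≡⟨ four-times x y ⟩
    z * z + + 3 * (y * y)                  ≡⟨ cong₂ (λ p q → p + + 3 * q) (square-ℕ z) (square-ℕ y) ⟩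
    + Z² + + 3 * + Y²                      ≡⟨ cong (_+_ (+ Z²)) (ℤₚ.pos-* 3 Y²) ⟨
    + Z² + + (3 ℕ.* Y²)                    ≡⟨ ℤₚ.pos-+ Z² (3 ℕ.* Y²) ⟨
    + (Z² ℕ.+ 3 ℕ.* Y²)                    ∎)
    where open ≡-Reasoning

zero-or-positive : ∀ {t} K → t ≡ + K → t ≡ 0ℤ ⊎ ∃ λ N → t ≡ + suc N
zero-or-positive zero t≡0 = inj₁ t≡0
zero-or-positive (suc N) t>0 = inj₂ (N , t>0)

-- Reduction of positive definite binary quadratic forms

record Form : Set where
  constructor ⟨_,_,_⟩
  field
    a : ℕ
    b : ℤ
    c : ℕ

value : Form → ℤ → ℤ → ℤ
value ⟨ a , b , c ⟩ x y = + a * (x * x) + + 2 * b * (x * y) + + c * (y * y)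

det : Form → ℤ
det ⟨ a , b , c ⟩ = + a * + c - b * b

Reduced : Form → Set
Reduced ⟨ a , b , c ⟩ = 2 ℕ.* ∣ b ∣ ℕ.≤ a × a ℕ.≤ c

infix 4 _≼_

record _≼_ (f g : Form) : Set where
  field
    det-≡ : det g ≡ det f
    values-⊆ : Represented (value f) ⊆ Represented (value g)

open _≼_

≼-trans : ∀ {f g h} → f ≼ g → g ≼ h → f ≼ h
≼-trans f≼g g≼h = record
  { det-≡ = trans (det-≡ g≼h) (det-≡ f≼g)
  ; values-⊆ = λ n∈f → values-⊆ g≼h (values-⊆ f≼g n∈f)
  }

translate-det : ∀ a b c k → a * (c - + 2 * k * b + k * k * a) - (b - k * a) * (b - k * a) ≡ a * c - b * b
translate-det = solve-∀

translate-≼ : ∀ {a b c} k {c′} → + c′ ≡ + c - + 2 * k * b + k * k * + a →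
              ⟨ a , b , c ⟩ ≼ ⟨ a , b - k * + a , c′ ⟩
translate-≼ {a} {b} {c} k {c′} c′≡ = record
  { det-≡ = trans (cong (λ z → + a * z - (b - k * + a) * (b - k * + a)) c′≡) (translate-det (+ a) b (+ c) k)
  ; values-⊆ = λ { (x , y , n≡) → x + k * y , y ,
      trans n≡ (trans (same-value (+ a) b (+ c) k x y) (cong (λ z → value′ z (x + k * y) y) (sym c′≡))) }
  }
  where
  value′ : ℤ → ℤ → ℤ → ℤ
  value′ c′ X Y = + a * (X * X) + + 2 * (b - k * + a) * (X * Y) + c′ * (Y * Y)
  same-value : ∀ a b c k x y → a * (x * x) + + 2 * b * (x * y) + c * (y * y)
               ≡ a * ((x + k * y) * (x + k * y)) + + 2 * (b - k * a) * ((x + k * y) * y)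
                 + (c - + 2 * k * b + k * k * a) * (y * y)
  same-value = solve-∀

swap-≼ : ∀ {a b c} → ⟨ a , b , c ⟩ ≼ ⟨ c , - b , a ⟩
swap-≼ {a} {b} {c} = record
  { det-≡ = same-det (+ a) b (+ c)
  ; values-⊆ = λ { (x , y , n≡) → - y , x , trans n≡ (same-value (+ a) b (+ c) x y) }
  }
  where
  same-det : ∀ a b c → c * a - (- b) * (- b) ≡ a * c - b * b
  same-det = solve-∀
  same-value : ∀ a b c x y → a * (x * x) + + 2 * b * (x * y) + c * (y * y)
                            ≡ c * (- y * - y) + + 2 * - b * (- y * x) + a * (x * x)
  same-value = solve-∀

balanced-remainder : ∀ b a .{{_ : NonZero a}} → ∃ λ k → 2 ℕ.* ∣ b - k * + a ∣ ℕ.≤ a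
balanced-remainder b a = choose (2 ℕ.* r ℕ.≤? a)
  where
  open ℕₚ.≤-Reasoning
  r = b %ℕ a
  q = b /ℕ a
  r<a : r < a
  r<a = n%ℕd<d b a
  b-qa≡r : b - q * + a ≡ + r
  b-qa≡r = trans (cong (_- q * + a) (a≡a%ℕn+[a/ℕn]*n b a)) (cancel (+ r) (q * + a))
    where
    cancel : ∀ r x → r + x - x ≡ r
    cancel = solve-∀
  ∣b-[q+1]a∣≡a∸r : ∣ b - (q + 1ℤ) * + a ∣ ≡ a ℕ.∸ r
  ∣b-[q+1]a∣≡a∸r = begin-equality
    ∣ b - (q + 1ℤ) * + a ∣        ≡⟨ cong ∣_∣ (trans (shift b q (+ a)) (cong (_- + a) b-qa≡r)) ⟩
    ∣ + r - + a ∣                 ≡⟨ cong ∣_∣ (ℤₚ.m-n≡m⊖n r a) ⟩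
    ∣ r ℤ.⊖ a ∣                   ≡⟨ ℤₚ.∣⊖∣-< r<a ⟩
    a ℕ.∸ r                       ∎
    where
    shift : ∀ b q a → b - (q + 1ℤ) * a ≡ b - q * a - a
    shift = solve-∀
  choose : Dec (2 ℕ.* r ℕ.≤ a) → ∃ λ k → 2 ℕ.* ∣ b - k * + a ∣ ℕ.≤ a
  choose (yes 2r≤a) = q , subst (λ z → 2 ℕ.* ∣ z ∣ ℕ.≤ a) (sym b-qa≡r) 2r≤a
  choose (no 2r≰a) = q + 1ℤ , (begin
    2 ℕ.* ∣ b - (q + 1ℤ) * + a ∣   ≡⟨ cong (2 ℕ.*_) ∣b-[q+1]a∣≡a∸r ⟩
    2 ℕ.* (a ℕ.∸ r)                ≡⟨ cong (a ℕ.∸ r ℕ.+_) (ℕₚ.+-identityʳ (a ℕ.∸ r)) ⟩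
    a ℕ.∸ r ℕ.+ (a ℕ.∸ r)          ≤⟨ ℕₚ.+-monoʳ-≤ (a ℕ.∸ r) (ℕₚ.m≤n+o⇒m∸n≤o a r a≤r+r) ⟩
    a ℕ.∸ r ℕ.+ r                  ≡⟨ ℕₚ.m∸n+n≡m (ℕₚ.<⇒≤ r<a) ⟩
    a                              ∎)
    where
    a≤r+r : a ℕ.≤ r ℕ.+ r
    a≤r+r = subst (a ℕ.≤_) (cong (r ℕ.+_) (ℕₚ.+-identityʳ r)) (ℕₚ.<⇒≤ (ℕₚ.≰⇒> 2r≰a))

det-positive⇒c-positive : ∀ a b c {D} → + a * c - b * b ≡ + suc D → ∃ λ c′ → c ≡ + suc c′
det-positive⇒c-positive a b c {D} det≡ = positive-factor a c (begin
  + a * c                          ≡⟨ shift (+ a * c) (b * b) ⟩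
  + a * c - b * b + b * b          ≡⟨ cong₂ _+_ det≡ (square-ℕ b) ⟩
  + suc D + + (∣ b ∣ ℕ.* ∣ b ∣)    ≡⟨ ℤₚ.pos-+ (suc D) (∣ b ∣ ℕ.* ∣ b ∣) ⟨
  + suc (D ℕ.+ ∣ b ∣ ℕ.* ∣ b ∣)    ∎)
  where
  open ≡-Reasoning
  shift : ∀ x y → x ≡ x - y + y
  shift = solve-∀

Reduction : Form → Set
Reduction f = ∃ λ g → Reduced g × f ≼ g

≼-reduction : ∀ {f f′} → f ≼ f′ → Reduction f′ → Reduction f
≼-reduction f≼f′ (g , reduced , f′≼g) = g , reduced , ≼-trans f≼f′ f′≼g

reduce : ∀ {D} a b c → det ⟨ a , b , c ⟩ ≡ + suc D → .{{_ : NonZero a}} → Acc _<_ a →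
         Reduction ⟨ a , b , c ⟩
reduce {D} a b c det≡ (acc smaller) with balanced-remainder b a
... | k , bound with det-positive⇒c-positive a (b - k * + a) (+ c - + 2 * k * b + k * k * + a)
                       (trans (translate-det (+ a) b (+ c) k) det≡)
...   | c′ , c′≡ with a ℕ.≤? suc c′
...     | yes a≤c′ = ⟨ a , b - k * + a , suc c′ ⟩ , (bound , a≤c′) , translate-≼ k (sym c′≡)
...     | no a≰c′ =
  ≼-reduction f≼f′ (reduce (suc c′) _ a (trans (det-≡ f≼f′) det≡) (smaller (ℕₚ.≰⇒> a≰c′)))
  where
  f≼f′ : ⟨ a , b , c ⟩ ≼ ⟨ suc c′ , - (b - k * + a) , a ⟩
  f≼f′ = ≼-trans (translate-≼ k (sym c′≡)) swap-≼

√-D⇒form : ∀ {D n} → √ - + suc D mod + suc n → ∃₂ λ b c → det ⟨ suc n , b , suc c ⟩ ≡ + suc D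
√-D⇒form {D} {n} (mk√ q k q²≡) =
  q , proj₁ k>0 , subst (λ z → + suc n * z - q * q ≡ + suc D) (proj₂ k>0) det≡
  where
  det≡ : + suc n * k - q * q ≡ + suc D
  det≡ = trans (cong (λ z → + suc n * k - z) q²≡) (cancel (+ suc n * k) (+ suc D))
    where
    cancel : ∀ x d → x - (- d + x) ≡ d
    cancel = solve-∀
  k>0 = det-positive⇒c-positive (suc n) q k det≡

reduced-representative : ∀ {f D n} → det f ≡ + suc D → Represented (value f) n → Reduction f →
                         ∃ λ g → Reduced g × det g ≡ + suc D × Represented (value g) n
reduced-representative det≡ n∈f (g , reduced , f≼g) =
  g , reduced , trans (det-≡ f≼g) det≡ , values-⊆ f≼g n∈f

√-D⇒reduced-representation : ∀ {D n} → √ - + suc D mod + suc n →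
                             ∃ λ g → Reduced g × det g ≡ + suc D × Represented (value g) (+ suc n)
√-D⇒reduced-representation {D} {n} root = represent (√-D⇒form {D} {n} root)
  where
  at-1-0 : ∀ a b c → a * (1ℤ * 1ℤ) + + 2 * b * (1ℤ * 0ℤ) + c * (0ℤ * 0ℤ) ≡ a
  at-1-0 = solve-∀
  represent : (∃₂ λ b c → det ⟨ suc n , b , suc c ⟩ ≡ + suc D) →
              ∃ λ g → Reduced g × det g ≡ + suc D × Represented (value g) (+ suc n)
  represent (b , c , det≡) = reduced-representative det≡ (1ℤ , 0ℤ , sym (at-1-0 (+ suc n) b (+ suc c)))
                               (reduce (suc n) b (suc c) det≡ (<-wellFounded (suc n)))

det-ℕ : ∀ a b c {D} → det ⟨ a , b , c ⟩ ≡ + D → a ℕ.* c ≡ D ℕ.+ ∣ b ∣ ℕ.* ∣ b ∣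
det-ℕ a b c {D} det≡ = ℤₚ.+-injective (begin
  + (a ℕ.* c)                      ≡⟨ ℤₚ.pos-* a c ⟩
  + a * + c                        ≡⟨ shift (+ a * + c) (b * b) ⟩
  + a * + c - b * b + b * b        ≡⟨ cong₂ _+_ det≡ (square-ℕ b) ⟩
  + D + + (∣ b ∣ ℕ.* ∣ b ∣)        ≡⟨ ℤₚ.pos-+ D (∣ b ∣ ℕ.* ∣ b ∣) ⟨
  + (D ℕ.+ ∣ b ∣ ℕ.* ∣ b ∣)        ∎)
  where
  open ≡-Reasoning
  shift : ∀ x y → x ≡ x - y + y
  shift = solve-∀

reduced-bound : ∀ a c ρ D → a ℕ.* c ≡ D ℕ.+ ρ ℕ.* ρ → 2 ℕ.* ρ ℕ.≤ a → a ℕ.≤ c →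
                3 ℕ.* (a ℕ.* a) ℕ.≤ 4 ℕ.* D
reduced-bound a c ρ D ac≡ 2ρ≤a a≤c = ℕₚ.+-cancelʳ-≤ (a ℕ.* a) (3 ℕ.* (a ℕ.* a)) (4 ℕ.* D) (begin
  3 ℕ.* (a ℕ.* a) ℕ.+ a ℕ.* a         ≡⟨ four a ⟩
  4 ℕ.* (a ℕ.* a)                      ≤⟨ ℕₚ.*-monoʳ-≤ 4 (ℕₚ.*-monoʳ-≤ a a≤c) ⟩
  4 ℕ.* (a ℕ.* c)                      ≡⟨ cong (4 ℕ.*_) ac≡ ⟩
  4 ℕ.* (D ℕ.+ ρ ℕ.* ρ)                ≡⟨ expand D ρ ⟩
  4 ℕ.* D ℕ.+ 2 ℕ.* ρ ℕ.* (2 ℕ.* ρ)    ≤⟨ ℕₚ.+-monoʳ-≤ (4 ℕ.* D) (ℕₚ.*-mono-≤ 2ρ≤a 2ρ≤a) ⟩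
  4 ℕ.* D ℕ.+ a ℕ.* a                  ∎)
  where
  open ℕₚ.≤-Reasoning
  four : ∀ a → 3 ℕ.* (a ℕ.* a) ℕ.+ a ℕ.* a ≡ 4 ℕ.* (a ℕ.* a)
  four = ℕ-solve-∀
  expand : ∀ D ρ → 4 ℕ.* (D ℕ.+ ρ ℕ.* ρ) ≡ 4 ℕ.* D ℕ.+ 2 ℕ.* ρ ℕ.* (2 ℕ.* ρ)
  expand = ℕ-solve-∀

square-below : ∀ {a k m} → 3 ℕ.* (a ℕ.* a) ℕ.≤ m → m < 3 ℕ.* (suc k ℕ.* suc k) → a ℕ.≤ k
square-below {a} {k} 3a²≤m m<3k² with a ℕ.≤? k
... | yes a≤k = a≤k
... | no a≰k = ⊥-elim (ℕₚ.<-irrefl refl (ℕₚ.≤-<-trans (ℕₚ.≤-trans 3k²≤3a² 3a²≤m) m<3k²))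
  where
  k<a = ℕₚ.≰⇒> a≰k
  3k²≤3a² = ℕₚ.*-monoʳ-≤ 3 (ℕₚ.*-mono-≤ k<a k<a)

-- Opaque, so that `with` on these results does not normalise their proofs.
opaque
  reduced-det-1 : ∀ a c ρ → a ℕ.* c ≡ 1 ℕ.+ ρ ℕ.* ρ → 2 ℕ.* ρ ℕ.≤ a → a ℕ.≤ c →
                  a ≡ 1 × c ≡ 1 × ρ ≡ 0
  reduced-det-1 a c ρ ac≡ 2ρ≤a a≤c = ℕₚ.m*n≡1⇒m≡1 a c ac≡1 , ℕₚ.m*n≡1⇒n≡1 a c ac≡1 , ρ≡0
    where
    a≤1 : a ℕ.≤ 1
    a≤1 = square-below (reduced-bound a c ρ 1 ac≡ 2ρ≤a a≤c) (ℕₚ.≤ᵇ⇒≤ 5 12 _)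
    ρ≡0 : ρ ≡ 0
    ρ≡0 = ℕₚ.n<1⇒n≡0 (ℕₚ.*-cancelˡ-< 2 ρ 1 (ℕₚ.≤-<-trans (ℕₚ.≤-trans 2ρ≤a a≤1) (ℕₚ.n<1+n 1)))
    ac≡1 : a ℕ.* c ≡ 1
    ac≡1 = trans ac≡ (cong (λ r → 1 ℕ.+ r ℕ.* r) ρ≡0)

  reduced-det-3 : ∀ a c ρ → a ℕ.* c ≡ 3 ℕ.+ ρ ℕ.* ρ → 2 ℕ.* ρ ℕ.≤ a → a ℕ.≤ c →
                  (a ≡ 1 × c ≡ 3 × ρ ≡ 0) ⊎ (a ≡ 2 × c ≡ 2 × ρ ≡ 1)
  reduced-det-3 a c ρ ac≡ 2ρ≤a a≤c = cases a≤2 ρ<2 ac≡ 2ρ≤a a≤c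
    where
    a≤2 : a ℕ.≤ 2
    a≤2 = square-below (reduced-bound a c ρ 3 ac≡ 2ρ≤a a≤c) (ℕₚ.≤ᵇ⇒≤ 13 27 _)
    ρ<2 : ρ < 2
    ρ<2 = ℕₚ.*-cancelˡ-< 2 ρ 2 (ℕₚ.≤-<-trans (ℕₚ.≤-trans 2ρ≤a a≤2) (ℕₚ.≤ᵇ⇒≤ 3 4 _))
    cases : ∀ {a c ρ} → a ℕ.≤ 2 → ρ < 2 → a ℕ.* c ≡ 3 ℕ.+ ρ ℕ.* ρ → 2 ℕ.* ρ ℕ.≤ a → a ℕ.≤ c →
            (a ≡ 1 × c ≡ 3 × ρ ≡ 0) ⊎ (a ≡ 2 × c ≡ 2 × ρ ≡ 1)
    cases z≤n _ () _ _
    cases (s≤s z≤n) (s≤s z≤n) ac≡ _ _ = inj₁ (refl , trans (sym (ℕₚ.+-identityʳ _)) ac≡ , refl)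
    cases (s≤s z≤n) (s≤s (s≤s z≤n)) _ (s≤s ()) _
    cases (s≤s (s≤s z≤n)) (s≤s z≤n) ac≡ _ a≤c =
      ⊥-elim (ℕₚ.<-irrefl refl (subst (4 ℕ.≤_) ac≡ (ℕₚ.*-monoʳ-≤ 2 a≤c)))
    cases {c = c} (s≤s (s≤s z≤n)) (s≤s (s≤s z≤n)) ac≡ _ _ = inj₂ (refl , ℕₚ.*-cancelˡ-≡ c 2 2 ac≡ , refl)

reduced-det-1-values : ∀ g → Reduced g → det g ≡ 1ℤ → Represented (value g) ⊆ Represented x²+y²
reduced-det-1-values ⟨ a , + ρ , c ⟩ (bound , a≤c) det≡ (x , y , n≡)
  with reduced-det-1 a c ρ (det-ℕ a (+ ρ) c det≡) bound a≤c
... | refl , refl , refl = x , y , trans n≡ (principal x y)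
  where
  principal : ∀ x y → + 1 * (x * x) + + 2 * + 0 * (x * y) + + 1 * (y * y) ≡ x * x + y * y
  principal = solve-∀
reduced-det-1-values ⟨ a , -[1+ ρ ] , c ⟩ (bound , a≤c) det≡ _
  with reduced-det-1 a c (suc ρ) (det-ℕ a -[1+ ρ ] c det≡) bound a≤c
... | _ , _ , ()

reduced-det-3-values : ∀ g → Reduced g → det g ≡ + 3 →
                       Represented (value g) ⊆ Represented x²+3y² ∪ Represented 2[x²-xy+y²]
reduced-det-3-values ⟨ a , + ρ , c ⟩ (bound , a≤c) det≡ (x , y , n≡)
  with reduced-det-3 a c ρ (det-ℕ a (+ ρ) c det≡) bound a≤c
... | inj₁ (refl , refl , refl) = inj₁ (x , y , trans n≡ (principal x y))
  where
  principal : ∀ x y → + 1 * (x * x) + + 2 * + 0 * (x * y) + + 3 * (y * y) ≡ x * x + + 3 * (y * y)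
  principal = solve-∀
... | inj₂ (refl , refl , refl) = inj₂ (x , - y , trans n≡ (twice-eisenstein x y))
  where
  twice-eisenstein : ∀ x y → + 2 * (x * x) + + 2 * + 1 * (x * y) + + 2 * (y * y) ≡ + 2 * (x * x - x * - y + - y * - y)
  twice-eisenstein = solve-∀
reduced-det-3-values ⟨ a , -[1+ ρ ] , c ⟩ (bound , a≤c) det≡ (x , y , n≡)
  with reduced-det-3 a c (suc ρ) (det-ℕ a -[1+ ρ ] c det≡) bound a≤c
... | inj₁ (_ , _ , ())
... | inj₂ (refl , refl , refl) = inj₂ (x , y , trans n≡ (twice-eisenstein x y))
  where
  twice-eisenstein : ∀ x y → + 2 * (x * x) + + 2 * -1ℤ * (x * y) + + 2 * (y * y) ≡ + 2 * (x * x - x * y + y * y)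
  twice-eisenstein = solve-∀

√-1⇒x²+y² : ∀ {m n} → m ≡ + suc n → √ -1ℤ mod m → Represented x²+y² m
√-1⇒x²+y² refl root =
  let g , reduced , det≡ , n∈g = √-D⇒reduced-representation root in reduced-det-1-values g reduced det≡ n∈g

√-3⇒x²+3y²∪2[x²-xy+y²] : ∀ {m n} → m ≡ + suc n → √ - + 3 mod m →
                         (Represented x²+3y² ∪ Represented 2[x²-xy+y²]) m
√-3⇒x²+3y²∪2[x²-xy+y²] refl root =
  let g , reduced , det≡ , n∈g = √-D⇒reduced-representation root in reduced-det-3-values g reduced det≡ n∈g

cofactor-not-x²+3y² : ∀ {x y} → Coprime x y → ∀ h m → 3x²-y² x y ≡ h * h * m →
                      Represented x²+y² m → Represented x²+3y² m → ⊥
cofactor-not-x²+3y² coprime h m t≡h²m m∈x²+y² m∈x²+3y² =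
  disjoint (3x²-y²-mod-4 coprime)
    (subst (λ r → r ≡ 0 ⊎ r ≡ 1) (cong (_%ℕ 4) (sym t≡h²m))
      (square-*-mod-4 h m (x²+y²∩x²+3y²-mod-4 m∈x²+y² m∈x²+3y²)))
  where
  disjoint : ∀ {r} → r ≡ 2 ⊎ r ≡ 3 → r ≡ 0 ⊎ r ≡ 1 → ⊥
  disjoint (inj₁ refl) (inj₁ ())
  disjoint (inj₁ refl) (inj₂ ())
  disjoint (inj₂ refl) (inj₁ ())
  disjoint (inj₂ refl) (inj₂ ())

forward-positive : ∀ {t N} x y a b → t ≡ + suc N → t ≡ 3x²-y² x y → t ≡ x²+y² a b →
                   Represented 2[x²-xy+y²] t
forward-positive {t} x y a b t>0 t≡3x²-y² t≡a²+b² =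
  conclude (√-3⇒x²+3y²∪2[x²-xy+y²] m>0 (√-* √-1 √3))
  where
  module F = GcdFactorisation (gcdFactorisation x y)
  module G = GcdFactorisation (gcdFactorisation a b)
  open CommonCofactor (common-cofactor F.g G.g (3x²-y² F.x₀ F.y₀) (x²+y² G.x₀ G.y₀)
    (trans t≡3x²-y² (factor-out 3x²-y² 3x²-y²-homogeneous (gcdFactorisation x y)))
    (trans t≡a²+b² (factor-out x²+y² x²+y²-homogeneous (gcdFactorisation a b)))
    (λ t≡0 → ℕₚ.0≢1+n (ℤₚ.+-injective (trans (sym t≡0) t>0))))
  m>0 = proj₂ (square-*-positive s m (trans (sym t≡s²m) t>0))
  √3 : √ + 3 mod m
  √3 = √-mod-divisor (h * h) m A≡h²m (√3-mod-3x²-y² F.coprime)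
  √-1 : √ -1ℤ mod m
  √-1 = √-mod-divisor (g * g) m B≡g²m (√-1-mod-x²+y² G.coprime)
  conclude : (Represented x²+3y² ∪ Represented 2[x²-xy+y²]) m → Represented 2[x²-xy+y²] t
  conclude (inj₁ m∈x²+3y²) =
    ⊥-elim (cofactor-not-x²+3y² F.coprime h m A≡h²m (√-1⇒x²+y² m>0 √-1) m∈x²+3y²)
  conclude (inj₂ (p , q , m≡)) =
    s * p , s * q , trans t≡s²m (trans (cong (s * s *_) m≡) (sym (2[x²-xy+y²]-homogeneous s p q)))

2[x²-xy+y²]-cofactor : ∀ {x y} → Coprime x y → ∀ g m → 2[x²-xy+y²] x y ≡ g * g * m →
                       ∃ λ m′ → m ≡ + 2 * m′ × x²-xy+y² x y ≡ g * g * m′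
2[x²-xy+y²]-cofactor {x} {y} coprime g m 2e≡g²m = m′ , m≡2m′ , ℤₚ.*-cancelˡ-≡ (+ 2) _ _ (begin
  + 2 * x²-xy+y² x y        ≡⟨ 2e≡g²m ⟩
  g * g * m                 ≡⟨ cong (g * g *_) m≡2m′ ⟩
  g * g * (+ 2 * m′)        ≡⟨ swap g m′ ⟩
  + 2 * (g * g * m′)        ∎)
  where
  open ≡-Reasoning
  m′ = 1ℤ + + 2 * (m /ℕ 4)
  m≡2m′ : m ≡ + 2 * m′
  m≡2m′ = trans (Mod4.divMod m (2e≡g²m⇒m≡2-mod-4 (x²-xy+y² x y) g m (x²-xy+y²-mod-4 coprime) 2e≡g²m))
                (halve (m /ℕ 4))
    where
    halve : ∀ q → + 2 + q * + 4 ≡ + 2 * (1ℤ + + 2 * q)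
    halve = solve-∀
  swap : ∀ g m′ → g * g * (+ 2 * m′) ≡ + 2 * (g * g * m′)
  swap = solve-∀

backward-positive : ∀ {t N} x y m k → t ≡ + suc N → t ≡ 3x²-y² x y → t ≡ 2[x²-xy+y²] m k →
                    Represented x²+y² t
backward-positive {t} x y m k t>0 t≡3x²-y² t≡2e = s * (p + q) , s * (p - q) , (begin
  t                                  ≡⟨ t≡s²2M′ ⟩
  s * s * (+ 2 * M′)                 ≡⟨ cong (λ z → s * s * (+ 2 * z)) M′≡p²+q² ⟩
  s * s * (+ 2 * (p * p + q * q))    ≡⟨ two-squares s p q ⟩
  x²+y² (s * (p + q)) (s * (p - q))  ∎)
  where
  open ≡-Reasoning
  module F = GcdFactorisation (gcdFactorisation x y)
  module G = GcdFactorisation (gcdFactorisation m k)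
  open CommonCofactor (common-cofactor F.g G.g (3x²-y² F.x₀ F.y₀) (2[x²-xy+y²] G.x₀ G.y₀)
    (trans t≡3x²-y² (factor-out 3x²-y² 3x²-y²-homogeneous (gcdFactorisation x y)))
    (trans t≡2e (factor-out 2[x²-xy+y²] 2[x²-xy+y²]-homogeneous (gcdFactorisation m k)))
    (λ t≡0 → ℕₚ.0≢1+n (ℤₚ.+-injective (trans (sym t≡0) t>0)))) renaming (m to M)
  halved = 2[x²-xy+y²]-cofactor G.coprime g M B≡g²m
  M′ = proj₁ halved
  M≡2M′ = proj₁ (proj₂ halved)
  e≡g²M′ = proj₂ (proj₂ halved)
  t₀≡h²2M′ : 3x²-y² F.x₀ F.y₀ ≡ h * h * (+ 2 * M′)
  t₀≡h²2M′ = trans A≡h²m (cong (h * h *_) M≡2M′)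
  t≡s²2M′ : t ≡ s * s * (+ 2 * M′)
  t≡s²2M′ = trans t≡s²m (cong (s * s *_) M≡2M′)
  M′>0 = proj₂ (positive-factor 2 M′ (proj₂ (square-*-positive s (+ 2 * M′) (trans (sym t≡s²2M′) t>0))))
  √3 : √ + 3 mod M′
  √3 = √-mod-divisor (h * h * + 2) M′ (trans t₀≡h²2M′ (regroup h M′)) (√3-mod-3x²-y² F.coprime)
    where
    regroup : ∀ h M′ → h * h * (+ 2 * M′) ≡ h * h * + 2 * M′
    regroup = solve-∀
  √-3 : √ - + 3 mod M′
  √-3 = √-mod-divisor (g * g) M′ e≡g²M′ (√-3-mod-x²-xy+y² G.coprime)
  √-1 : √ -1ℤ mod M′
  3-unit : Coprime (+ 3) M′
  3-unit = unit-mod-3 M′ (3∤common-cofactor F.coprime G.coprime h g M′ t₀≡h²2M′ e≡g²M′)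
  √-1 = √-cancel 3-unit -1ℤ (√-* √-3 √3)
  M′-sum = √-1⇒x²+y² M′>0 √-1
  p = proj₁ M′-sum
  q = proj₁ (proj₂ M′-sum)
  M′≡p²+q² = proj₂ (proj₂ M′-sum)
  two-squares : ∀ s p q → s * s * (+ 2 * (p * p + q * q)) ≡ s * (p + q) * (s * (p + q)) + s * (p - q) * (s * (p - q))
  two-squares = solve-∀

forward : ∀ t x y → t ≡ 3x²-y² x y → Represented x²+y² t → Represented 2[x²-xy+y²] t
forward t x y t≡3x²-y² (a , b , t≡a²+b²) =
  [ (λ t≡0 → 0ℤ , 0ℤ , t≡0) , (λ (_ , t>0) → forward-positive x y a b t>0 t≡3x²-y² t≡a²+b²) ]′
    (zero-or-positive _ (trans t≡a²+b² (proj₂ (x²+y²-nonNegative a b))))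

backward : ∀ t x y → t ≡ 3x²-y² x y → Represented 2[x²-xy+y²] t → Represented x²+y² t
backward t x y t≡3x²-y² (m , k , t≡2e) =
  [ (λ t≡0 → 0ℤ , 0ℤ , t≡0) , (λ (_ , t>0) → backward-positive x y m k t>0 t≡3x²-y² t≡2e) ]′
    (zero-or-positive _ (trans t≡2e (proj₂ (2[x²-xy+y²]-nonNegative m k))))

lemma5p2 : (t x y : ℤ) → t ≡ + 3 * (x * x) - y * y →
    ((∃₂ λ a b → t ≡ a * a + b * b) → (∃₂ λ m n → t ≡ + 2 * (m * m - m * n + n * n)))
    × ((∃₂ λ m n → t ≡ + 2 * (m * m - m * n + n * n)) → (∃₂ λ a b → t ≡ a * a + b * b))
lemma5p2 t x y t≡3x²-y² = forward t x y t≡3x²-y² , backward t x y t≡3x²-y²
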